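{- Let $\rho$ be a typing derivation of a program that is safe with respect to a variable typing environment $\Gamma$ and a safe operator typing environment $\Delta$. Let $\rho_1\in\mathcal{D}(\rho)$ have root $\Gamma,\Delta\vdash\mathtt{while}(e_1)\{c_1\}:(t^1,t^1_{in},t^1_{out})$ and last rule $R$, and let $\rho_2\in\mathring{\mathcal{D}}(\rho_1)$ have root $\Gamma,\Delta\vdash c_2:(t^2,t^2_{in},t^2_{out})$ with $c_2$ a command. If $R\in\{(\mathrm{W}),(\mathrm{W}_0)\}$, then $t^1\preceq t^2_{out}$.
   Context: Programs. Fix a set of variables and a set of operators, each operator $\mathtt{op}$ having an arity $ar(\mathtt{op})\ge0$ and a total function $[\![\mathtt{op}]\!]$ on words. With a single oracle symbol $\phi$: expressions $e::=x\mid \mathtt{op}(e_1,\dots,e_{ar(\mathtt{op})})\mid \phi(e_1\upharpoonright e_2)$; commands $c::=\mathtt{skip}\mid x:=e\mid c_1;c_2\mid \mathtt{if}(e)\{c_1\}\,\mathtt{else}\,\{c_0\}\mid \mathtt{while}(e)\{c\}$; programs $p_\phi::=c\ \mathtt{return}\ x$. Operators. For words, $v\unlhd w$ means $v$ is a contiguous subword of $w$. $\mathtt{op}$ is neutral if $ar(\mathtt{op})=0$, or $[\![\mathtt{op}]\!]$ takes values in $\{0,1\}$, or for all $\bar w$ there is $i$ with $[\![\mathtt{op}]\!](\bar w)\unlhd w_i$. $\mathtt{op}$ is positive if there is a constant $c$ with $|[\![\mathtt{op}]\!](\bar w)|\le\max_i|w_i|+c$ for all $\bar w$. Typing. Tiers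 are natural numbers $\mathbf 0,\mathbf 1,\dots$ with the usual order $\preceq$ (strict: $\prec$), $\vee=\max$, $\wedge=\min$. A variable typing environment $\Gamma$ maps variables to tiers; an operator typing environment $\Delta$ assigns to each operator $\mathtt{op}$ and tier $t$ a set $\Delta(\mathtt{op})(t)$ of types $t_1\to\dots\to t_{ar(\mathtt{op})}\to t'$. Judgments $\Gamma,\Delta\vdash b:(t,t_{in},t_{out})$ are derived by the rules (writing $\vdash$ for $\Gamma,\Delta\vdash$, all tiers arbitrary): (V) $\vdash x:(\Gamma(x),t_{in},t_{out})$; (OP) if $t_1\to\dots\to t_n\to t\in\Delta(\mathtt{op})(t_{in})$ and $\vdash e_i:(t_i,t_{in},t_{out})$ for all $i\le n=ar(\mathtt{op})$ then $\vdash\mathtt{op}(e_1,\dots,e_n):(t,t_{in},t_{out})$; (OR) if $\vdash e_1:(t,t_{in},t_{out})$, $\vdash e_2:(t_{out},t_{in},t_{out})$, $t\prec t_{in}$ and $t\preceq t_{out}$ then $\vdash\phi(e_1\upharpoonright e_2):(t,t_{in},t_{out})$; (SUB) for a command $c$, if $\vdash c:(t,t_{in},t_{out})$ then $\vdash c:(t+1,t_{in},t_{out})$; (SK) $\vdash\mathtt{skip}:(\mathbf0,t_{in},t_{out})$; (A) if $\vdash x:(t_1,t_{in},t_{out})$, $\vdash e:(t_2,t_{in},t_{out})$, $t_1\preceq t_2$ then $\vdash x:=e:(t_1,t_{in},t_{out})$; (S) if $\vdash c_1:\tau$ and $\vdash c_2:\tau$ then $\vdash c_1;c_2:\tau$;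 (C) if $\vdash e:\tau$, $\vdash c_1:\tau$, $\vdash c_0:\tau$ then $\vdash\mathtt{if}(e)\{c_1\}\mathtt{else}\{c_0\}:\tau$; (W) if $\vdash e:(t,t_{in},t_{out})$, $\vdash c:(t,t,t_{out})$ and $\mathbf1\preceq t\preceq t_{out}$ then $\vdash\mathtt{while}(e)\{c\}:(t,t_{in},t_{out})$; (W$_0$) if $\vdash e:(t,t_{in},t)$, $\vdash c:(t,t,t)$ and $\mathbf1\preceq t$ then $\vdash\mathtt{while}(e)\{c\}:(t,t_{in},\mathbf0)$. A typing derivation is a tree of instances of these rules; for a derivation $\rho$, $\mathcal{D}(\rho)$ is the set of its subtrees (including $\rho$) and $\mathring{\mathcal{D}}(\rho)=\mathcal{D}(\rho)\setminus\{\rho\}$. A typing derivation of a program $c\ \mathtt{return}\ x$ is one whose root is a judgment $\Gamma,\Delta\vdash c:(t,t_{in},t_{out})$. Safety. $\Delta$ is safe if for each operator $\mathtt{op}$ it types with $ar(\mathtt{op})>0$: $\mathtt{op}$ is neutral or positive, $[\![\mathtt{op}]\!]$ is polynomial-time computable, and for every tier $t_{in}$ and every $t_1\to\dots\to t_n\to t\in\Delta(\mathtt{op})(t_{in})$: $t\preceq\wedge_i t_i\preceq\vee_i t_i\preceq t_{in}$, and $t\prec t_{in}$ if $\mathtt{op}$ is positive but not neutral. A program $c\ \mathtt{return}\ x$ is safe with respect to $\Gamma,\Delta$ if $\Delta$ is safe and $\Gamma,\Delta\vdash c:(t,t_{in},t_{out})$ for some tiers. -}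

module Defs where

open import Data.Nat using (ℕ; zero; suc; _≤_; _<_; _⊔_; _+_)
open import Data.Bool using (Bool; true; false)
open import Data.List using (List; []; _∷_; _++_; length)
open import Data.Vec using (Vec; lookup; foldr; map)
open import Data.Fin using (Fin)
open import Data.Product using (Σ; ∃; _×_; _,_)
open import Data.Sum using (_⊎_)
open import Relation.Binary.PropositionalEquality using (_≡_; _≢_)
open import Relation.Nullary using (¬_)
open import Data.Empty using (⊥)

Word : Set
Word = List Bool

w0 w1 : Word
w0 = false ∷ []
w1 = true ∷ []

_⊴_ : Word → Word → Set
v ⊴ w = Σ Word λ u → Σ Word λ z → w ≡ u ++ (v ++ z)

record Signature : Set₁ where
  field
    Var : Set
    Op  : Set
    ar  : Op → ℕ
    ⟦_⟧ : (o : Op) → Vec Word (ar o) → Word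

Tier : Set
Tier = ℕ

vmax : ∀ {n} → Vec ℕ n → ℕ
vmax = foldr (λ _ → ℕ) _⊔_ 0

module _ (Sig : Signature) where
  open Signature Sig

  data Expr : Set where
    var : Var → Expr
    op  : (o : Op) → (Fin (ar o) → Expr) → Expr
    orc : Expr → Expr → Expr

  data Cmd : Set where
    skip   : Cmd
    _:=_   : Var → Expr → Cmd
    _︔_    : Cmd → Cmd → Cmd
    if_then_else_ : Expr → Cmd → Cmd → Cmd
    while  : Expr → Cmd → Cmd

  data Prog : Set where
    _return_ : Cmd → Var → Prog

  Neutral : Op → Set
  Neutral o = (ar o ≡ 0)
            ⊎ (∀ ws → (⟦ o ⟧ ws ≡ w0) ⊎ (⟦ o ⟧ ws ≡ w1))
            ⊎ (∀ ws → Σ (Fin (ar o)) λ i → ⟦ o ⟧ ws ⊴ lookup ws i)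

  Positive : Op → Set
  Positive o = Σ ℕ λ c → ∀ ws → length (⟦ o ⟧ ws) ≤ vmax (map length ws) + c

  VarEnv : Set
  VarEnv = Var → Tier

  -- Δ(op)(t) is a set of types t₁ → … → t_n → t', represented as (t₁…t_n , t')
  OpEnv : Set₁
  OpEnv = (o : Op) → Tier → Vec Tier (ar o) → Tier → Set

  -- Safety of Δ, relative to a given notion PolyTime of polynomial-time computability.
  -- "op is typed by Δ" = Δ(op)(t) is nonempty for some t.
  SafeOpEnv : (PolyTime : ∀ {n} → (Vec Word n → Word) → Set) → OpEnv → Set
  SafeOpEnv PolyTime Δ =
    ∀ (o : Op) → 0 < ar o → (Σ Tier λ tin → Σ (Vec Tier (ar o)) λ ts → Σ Tier λ t → Δ o tin ts t) →
      (Neutral o ⊎ Positive o)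
    × PolyTime ⟦ o ⟧
    × (∀ tin ts t → Δ o tin ts t →
         (∀ i → t ≤ lookup ts i)
       × (∀ i → lookup ts i ≤ tin)          -- ∨ᵢ tᵢ ⪯ t_in  (∧ ⪯ ∨ holds as ar o > 0)
       × (Positive o → ¬ Neutral o → t < tin))

  data Judg : Set where
    jexp : Expr → Tier → Tier → Tier → Judg
    jcmd : Cmd  → Tier → Tier → Tier → Judg

  module Typing (Γ : VarEnv) (Δ : OpEnv) where

    data Der : Judg → Set where
      V   : ∀ {x tin tout} → Der (jexp (var x) (Γ x) tin tout)
      OP  : ∀ {o es t tin tout} (ts : Vec Tier (ar o)) → Δ o tin ts t →
            ((i : Fin (ar o)) → Der (jexp (es i) (lookup ts i) tin tout)) →
            Der (jexp (op o es) t tin tout)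
      OR  : ∀ {e₁ e₂ t tin tout} → Der (jexp e₁ t tin tout) → Der (jexp e₂ tout tin tout) →
            t < tin → t ≤ tout → Der (jexp (orc e₁ e₂) t tin tout)
      SUB : ∀ {c t tin tout} → Der (jcmd c t tin tout) → Der (jcmd c (suc t) tin tout)
      SK  : ∀ {tin tout} → Der (jcmd skip 0 tin tout)
      A   : ∀ {x e t₁ t₂ tin tout} → Der (jexp (var x) t₁ tin tout) → Der (jexp e t₂ tin tout) →
            t₁ ≤ t₂ → Der (jcmd (x := e) t₁ tin tout)
      S   : ∀ {c₁ c₂ t tin tout} → Der (jcmd c₁ t tin tout) → Der (jcmd c₂ t tin tout) →
            Der (jcmd (c₁ ︔ c₂) t tin tout)
      C   : ∀ {e c₁ c₀ t tin tout} → Der (jexp e t tin tout) → Der (jcmd c₁ t tin tout) →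
            Der (jcmd c₀ t tin tout) → Der (jcmd (if e then c₁ else c₀) t tin tout)
      W   : ∀ {e c t tin tout} → Der (jexp e t tin tout) → Der (jcmd c t t tout) →
            1 ≤ t → t ≤ tout → Der (jcmd (while e c) t tin tout)
      W₀  : ∀ {e c t tin} → Der (jexp e t tin t) → Der (jcmd c t t t) →
            1 ≤ t → Der (jcmd (while e c) t tin 0)

    data Rule : Set where
      rV rOP rOR rSUB rSK rA rS rC rW rW₀ : Rule

    lastRule : ∀ {j} → Der j → Rule
    lastRule V = rV
    lastRule (OP _ _ _) = rOP
    lastRule (OR _ _ _ _) = rOR
    lastRule (SUB _) = rSUB
    lastRule SK = rSK
    lastRule (A _ _ _) = rA
    lastRule (S _ _) = rS
    lastRule (C _ _ _) = rC
    lastRule (W _ _ _ _) = rW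
    lastRule (W₀ _ _ _) = rW₀

    Tree : Set
    Tree = Σ Judg Der

    Child : Tree → Tree → Set
    Child ρ' (_ , V) = ⊥
    Child ρ' (_ , OP _ _ ds) = Σ (Fin _) λ i → ρ' ≡ (_ , ds i)
    Child ρ' (_ , OR d₁ d₂ _ _) = ρ' ≡ (_ , d₁) ⊎ ρ' ≡ (_ , d₂)
    Child ρ' (_ , SUB d) = ρ' ≡ (_ , d)
    Child ρ' (_ , SK) = ⊥
    Child ρ' (_ , A d₁ d₂ _) = ρ' ≡ (_ , d₁) ⊎ ρ' ≡ (_ , d₂)
    Child ρ' (_ , S d₁ d₂) = ρ' ≡ (_ , d₁) ⊎ ρ' ≡ (_ , d₂)
    Child ρ' (_ , C d d₁ d₀) = ρ' ≡ (_ , d) ⊎ ρ' ≡ (_ , d₁) ⊎ ρ' ≡ (_ , d₀)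
    Child ρ' (_ , W d₁ d₂ _ _) = ρ' ≡ (_ , d₁) ⊎ ρ' ≡ (_ , d₂)
    Child ρ' (_ , W₀ d₁ d₂ _) = ρ' ≡ (_ , d₁) ⊎ ρ' ≡ (_ , d₂)

    data _∈𝒟_ : Tree → Tree → Set where
      here  : ∀ {ρ} → ρ ∈𝒟 ρ
      there : ∀ {ρ' ρ'' ρ} → ρ' ∈𝒟 ρ'' → Child ρ'' ρ → ρ' ∈𝒟 ρ

    _∈𝒟̊_ : Tree → Tree → Set
    ρ' ∈𝒟̊ ρ = ρ' ∈𝒟 ρ × ρ' ≢ ρ

-- Every typing rule except (W₀) passes the output tier t_out of its conclusion
-- unchanged to all of its premises, and (W₀) concludes t_out = 0.  Hence t_out is
-- constant throughout any subderivation whose root has a positive output tier.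
-- The premises of a while node typed by (W) or (W₀) have output tier at least the
-- tier t ⪰ 1 of the loop (t ⪯ t_out for (W); t_out = t for (W₀)), so the same bound
-- holds for every proper subderivation.
module Submission where

open import Defs
open import Data.Nat using (_≤_; _<_)
open import Data.Nat.Properties using (≤-refl; ≤-trans)
open import Data.Vec using (Vec)
open import Data.Product using (Σ-syntax; _×_; _,_; proj₁)
open import Data.Sum using (_⊎_; inj₁; inj₂)
open import Data.Empty using (⊥-elim)
open import Relation.Binary.PropositionalEquality using (_≡_; refl; sym; trans; subst)

module OutputTier (Sg : Signature) (Γ : VarEnv Sg) (Δ : OpEnv Sg) where
  open Typing Sg Γ Δ

  outTier : Judg Sg → Tier
  outTier (jexp _ _ _ tout) = tout
  outTier (jcmd _ _ _ tout) = tout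

  outTier-child : ∀ {ρ' ρ : Tree} → Child ρ' ρ → 0 < outTier (proj₁ ρ) →
                  outTier (proj₁ ρ') ≡ outTier (proj₁ ρ)
  outTier-child {ρ = _ , OP _ _ _}   (_ , refl)         _ = refl
  outTier-child {ρ = _ , OR _ _ _ _} (inj₁ refl)        _ = refl
  outTier-child {ρ = _ , OR _ _ _ _} (inj₂ refl)        _ = refl
  outTier-child {ρ = _ , SUB _}      refl               _ = refl
  outTier-child {ρ = _ , A _ _ _}    (inj₁ refl)        _ = refl
  outTier-child {ρ = _ , A _ _ _}    (inj₂ refl)        _ = refl
  outTier-child {ρ = _ , S _ _}      (inj₁ refl)        _ = refl
  outTier-child {ρ = _ , S _ _}      (inj₂ refl)        _ = refl
  outTier-child {ρ = _ , C _ _ _}    (inj₁ refl)        _ = refl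
  outTier-child {ρ = _ , C _ _ _}    (inj₂ (inj₁ refl)) _ = refl
  outTier-child {ρ = _ , C _ _ _}    (inj₂ (inj₂ refl)) _ = refl
  outTier-child {ρ = _ , W _ _ _ _}  (inj₁ refl)        _ = refl
  outTier-child {ρ = _ , W _ _ _ _}  (inj₂ refl)        _ = refl
  outTier-child {ρ = _ , W₀ _ _ _}   _                  ()

  outTier-subtree : ∀ {ρ' ρ : Tree} → ρ' ∈𝒟 ρ → 0 < outTier (proj₁ ρ) →
                    outTier (proj₁ ρ') ≡ outTier (proj₁ ρ)
  outTier-subtree here                  _   = refl
  outTier-subtree (there ρ'∈ρ'' ρ''≺ρ) pos = trans (outTier-subtree ρ'∈ρ'' pos') ρ''≡ρ
    where
    ρ''≡ρ = outTier-child ρ''≺ρ pos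
    pos'  = subst (0 <_) (sym ρ''≡ρ) pos

  ∈𝒟̊⇒∈𝒟-child : ∀ {ρ' ρ : Tree} → ρ' ∈𝒟̊ ρ → Σ[ ρ'' ∈ Tree ] ρ' ∈𝒟 ρ'' × Child ρ'' ρ
  ∈𝒟̊⇒∈𝒟-child (here , ρ≢ρ)               = ⊥-elim (ρ≢ρ refl)
  ∈𝒟̊⇒∈𝒟-child (there ρ'∈ρ'' ρ''≺ρ , _) = _ , ρ'∈ρ'' , ρ''≺ρ

  WhileRule : Rule → Set
  WhileRule r = r ≡ rW ⊎ r ≡ rW₀

  while-tier-positive : ∀ {e c t tin tout} (d : Der (jcmd (while e c) t tin tout)) →
                        WhileRule (lastRule d) → 0 < t
  while-tier-positive (SUB _)      (inj₁ ())
  while-tier-positive (SUB _)      (inj₂ ())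
  while-tier-positive (W _ _ 1≤t _) _ = 1≤t
  while-tier-positive (W₀ _ _ 1≤t)  _ = 1≤t

  while-child-outTier : ∀ {e c t tin tout} (d : Der (jcmd (while e c) t tin tout)) →
                        WhileRule (lastRule d) →
                        ∀ {ρ'} → Child ρ' (_ , d) → t ≤ outTier (proj₁ ρ')
  while-child-outTier (SUB _)          (inj₁ ())
  while-child-outTier (SUB _)          (inj₂ ())
  while-child-outTier (W _ _ _ t≤tout) _ (inj₁ refl) = t≤tout
  while-child-outTier (W _ _ _ t≤tout) _ (inj₂ refl) = t≤tout
  while-child-outTier (W₀ _ _ _)       _ (inj₁ refl) = ≤-refl
  while-child-outTier (W₀ _ _ _)       _ (inj₂ refl) = ≤-refl

  while-subtree-outTier : ∀ {e c t tin tout} (d : Der (jcmd (while e c) t tin tout)) →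
                          WhileRule (lastRule d) →
                          ∀ {ρ'} → ρ' ∈𝒟̊ (_ , d) → t ≤ outTier (proj₁ ρ')
  while-subtree-outTier d rule ρ'∈̊d with ∈𝒟̊⇒∈𝒟-child ρ'∈̊d
  ... | _ , ρ'∈ρ'' , ρ''≺d =
    subst (_ ≤_) (sym (outTier-subtree ρ'∈ρ'' (≤-trans (while-tier-positive d rule) t≤ρ''))) t≤ρ''
    where t≤ρ'' = while-child-outTier d rule ρ''≺d

lemma6p11 : (Sg : Signature)
    → (PolyTime : ∀ {n} → (Vec Word n → Word) → Set)
    → (Γ : VarEnv Sg) (Δ : OpEnv Sg)
    → SafeOpEnv Sg PolyTime Δ
    → (c : Cmd Sg) (x : Signature.Var Sg) (t tin tout : Tier)
    → (ρ : Typing.Der Sg Γ Δ (jcmd c t tin tout))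
    → (e₁ : Expr Sg) (c₁ : Cmd Sg) (t¹ t¹in t¹out : Tier)
    → (ρ₁ : Typing.Der Sg Γ Δ (jcmd (while e₁ c₁) t¹ t¹in t¹out))
    → Typing._∈𝒟_ Sg Γ Δ (_ , ρ₁) (_ , ρ)
    → (Typing.lastRule Sg Γ Δ ρ₁ ≡ Typing.rW ⊎ Typing.lastRule Sg Γ Δ ρ₁ ≡ Typing.rW₀)
    → (c₂ : Cmd Sg) (t² t²in t²out : Tier)
    → (ρ₂ : Typing.Der Sg Γ Δ (jcmd c₂ t² t²in t²out))
    → Typing._∈𝒟̊_ Sg Γ Δ (_ , ρ₂) (_ , ρ₁)
    → t¹ ≤ t²out
lemma6p11 Sg _ Γ Δ _ _ _ _ _ _ _ _ _ _ _ _ ρ₁ _ rule _ _ _ _ _ ρ₂∈̊ρ₁ =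
  OutputTier.while-subtree-outTier Sg Γ Δ ρ₁ rule ρ₂∈̊ρ₁
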